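{- Let $k\ge0$ and $i\in\{0,1,\dots,2k+1\}$ be integers, and let $s=k(k+1)+i$. Define \[ (x^{even}_s,y^{even}_s)=\begin{cases}(i,\,2(k-i)),&0\le i\le k,\\ (i-k-1,\,4k-2i+3),&k+1\le i\le 2k+1,\end{cases}\qquad (x^{odd}_s,y^{odd}_s)=\begin{cases}(2i,\,k-i),&0\le i\le k,\\ (2(i-k)-1,\,2k-i+1),&k+1\le i\le 2k+1,\end{cases} \] and $N^{even}_s=6\lfloor\sqrt{s+1}\rfloor-6$, $N^{odd}_s=6\left\lfloor\frac{\sqrt{4s+5}-1}{2}\right\rfloor-3$. Let $n$ be a positive integer with $n>N^{even}_s$ if $n$ is even and $n>N^{odd}_s$ if $n$ is odd, and set $(x_s,y_s)=(x^{even}_s,y^{even}_s)$ if $n$ is even and $(x_s,y_s)=(x^{odd}_s,y^{odd}_s)$ if $n$ is odd. Let $t_m=\frac{m(m+1)}{2}$ and $d_1=\gcd(t_{n+1},t_{n+2})$ (so $d_1=\frac{n+2}{2}$ for even $n$ and $d_1=n+2$ for odd $n$). Then \[ \operatorname{d}\!\left(\mathtt{g}\!\left(\frac{t_{n+1}}{d_1},\frac{t_{n+2}}{d_1};x_s\right)+y_s t_n;\ t_n,\frac{t_{n+1}}{d_1},\frac{t_{n+2}}{d_1}\right)=s. \]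
   Context: For positive integers $a_1,\dots,a_k$ with $\gcd(a_1,\dots,a_k)=1$ and an integer $m$, $\operatorname{d}(m;a_1,\dots,a_k)$ denotes the number of tuples of non-negative integers $(x_1,\dots,x_k)$ with $a_1x_1+\dots+a_kx_k=m$ (zero if $m<0$). For an integer $s\ge0$, $\mathtt{g}(a_1,\dots,a_k;s)=\max\{m\in\mathbb{Z}:\operatorname{d}(m;a_1,\dots,a_k)\le s\}$ (generalized Frobenius number). -}

module Defs where

open import Data.Nat using (ℕ; zero; suc; _+_; _*_; _∸_; _≤_; _<_; _≤ᵇ_; _≡ᵇ_; NonZero; ≢-nonZero; s≤s; z≤n)
open import Data.Nat.Properties using (m<n⇒n≢0)
open import Data.Nat.DivMod using (_/_; _%_; m≥n⇒m/n>0)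
open import Data.Nat.ListAction using (sum)
open import Data.Nat.GCD using (gcd; gcd[m,n]≢0)
open import Data.Bool using (Bool; true; false; if_then_else_)
open import Data.List using (List; []; _∷_; map; upTo)
open import Data.Integer as ℤ using (ℤ; +_; -[1+_])
open import Data.Product using (_×_)
open import Data.Sum using (inj₁)
open import Relation.Binary.PropositionalEquality using (_≢_)

-- d(m; a₁,…,a_k) for m ∈ ℕ: number of tuples (x₁,…,x_k) ∈ ℕ^k with Σ aⱼxⱼ = m.
-- Computed by splitting off the first variable x₁ (which ranges over 0..m when a₁ ≥ 1).
dℕ : List ℕ → ℕ → ℕ
dℕ [] zero = 1
dℕ [] (suc _) = 0
dℕ (a ∷ as) m = sum (map (λ x → if a * x ≤ᵇ m then dℕ as (m ∸ a * x) else 0) (upTo (suc m)))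

d : ℤ → List ℕ → ℕ
d (+ m) as = dℕ as m
d -[1+ _ ] as = 0

IsGFrob : List ℕ → ℕ → ℤ → Set
IsGFrob as s m = (d m as ≤ s) × (∀ m′ → m ℤ.< m′ → s < d m′ as)

t : ℕ → ℕ
t m = (m * suc m) / 2

t-suc≢0 : ∀ m → t (suc m) ≢ 0
t-suc≢0 m = m<n⇒n≢0 (m≥n⇒m/n>0 {suc m * suc (suc m)} {2} (s≤s (s≤s z≤n)))

d₁ : ℕ → ℕ
d₁ n = gcd (t (suc n)) (t (suc (suc n)))

instance-d₁ : ∀ n → NonZero (d₁ n)
instance-d₁ n = ≢-nonZero (gcd[m,n]≢0 (t (suc n)) (t (suc (suc n))) (inj₁ (t-suc≢0 n)))

b : ℕ → ℕ
b n = _/_ (t (suc n)) (d₁ n) {{instance-d₁ n}}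

c : ℕ → ℕ
c n = _/_ (t (suc (suc n))) (d₁ n) {{instance-d₁ n}}

largest : (ℕ → ℕ) → ℕ → ℕ → ℕ
largest f X zero = 0
largest f X (suc r) = if f (suc r) ≤ᵇ X then suc r else largest f X r

isqrt : ℕ → ℕ
isqrt X = largest (λ r → r * r) X X

-- ⌊(√X − 1)/2⌋ = largest r with (2r+1)² ≤ X   (for X ≥ 1)
ihalf : ℕ → ℕ
ihalf X = largest (λ r → (2 * r + 1) * (2 * r + 1)) X X

Neven : ℕ → ℤ
Neven s = + (6 * isqrt (s + 1)) ℤ.- + 6

Nodd : ℕ → ℤ
Nodd s = + (6 * ihalf (4 * s + 5)) ℤ.- + 3

xEven yEven xOdd yOdd : ℕ → ℕ → ℕ
xEven k i = if i ≤ᵇ k then i else i ∸ k ∸ 1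
yEven k i = if i ≤ᵇ k then 2 * (k ∸ i) else 4 * k + 3 ∸ 2 * i
xOdd k i = if i ≤ᵇ k then 2 * i else 2 * (i ∸ k) ∸ 1
yOdd k i = if i ≤ᵇ k then k ∸ i else 2 * k + 1 ∸ i

isEven : ℕ → Bool
isEven n = n % 2 ≡ᵇ 0

xs ys : ℕ → ℕ → ℕ → ℕ
xs n k i = if isEven n then xEven k i else xOdd k i
ys n k i = if isEven n then yEven k i else yOdd k i

Nbound : ℕ → ℕ → ℤ
Nbound n s = if isEven n then Neven s else Nodd s

-- Write B = t(n+1)/d₁ and C = t(n+2)/d₁.  Then t n = p B with p = n/2 for even n and p = n for
-- odd n, and B, C are coprime with B + C ≤ B C except for n = 1.  Peeling off the generator B shows
-- d(X; B, C) = J / C whenever X + C = B J, hence g(B, C; x) = frob + B x C with frob = B C − B − C.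
-- Peeling off p B in the same way, Λ Q = d(frob + B Q; p B, B, C) satisfies Λ 0 = 0 and
-- Λ Q = ⌈Q / C⌉ + Λ (Q ∸ p), so it counts the points (a, z) ∈ ℕ² with a C + z p < Q.  This count
-- is symmetric in C and p and splits as Λ (x C + y p) = x y + Λ (x C) + Λ (y p).  For
-- (C, p) = (n + 3, n/2) and ((n + 3)/2, n) the last two terms are sums of ceilings along arithmetic
-- progressions, which stay explicit while 3 k is below about n/2; that is what the bound on n
-- guarantees, and the sum comes out as k (k + 1) + i.

module Submission where

open import Defs
open import Data.Nat
open import Data.Nat.Properties
open import Data.Nat.DivMod
open import Data.Nat.Divisibility
open import Data.Nat.Coprimality as Coprimality using (Coprime; coprime-divisor; coprime-Bézout; coprime⇒gcd≡1)
open import Data.Nat.GCD using (module Bézout; gcd; c*gcd[m,n]≡gcd[cm,cn])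
open import Data.Nat.Induction using (<-rec)
open import Data.Nat.ListAction using (sum)
open import Data.List using (List; []; _∷_; applyUpTo)
open import Data.List.Properties using (map-upTo)
open import Data.Bool using (true; false; if_then_else_)
open import Data.Sum using (inj₁; inj₂)
open import Data.Product using (Σ; ∃₂; _×_; _,_; proj₁; proj₂)
open import Data.Integer as ℤ using (ℤ)
import Data.Integer.Properties as ℤᵖ
open import Relation.Nullary using (¬_; yes; no; contradiction)
open import Relation.Nullary.Decidable using (dec-true; dec-false)
open import Relation.Binary.PropositionalEquality hiding (J)
open import Function using (_∘_)
open import Data.Nat.Tactic.RingSolver using (solve; solve-∀)

-- Recurrences for the number of representations

applyUpTo-cong : ∀ {A : Set} {f g : ℕ → A} → (∀ i → f i ≡ g i) → ∀ n → applyUpTo f n ≡ applyUpTo g n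
applyUpTo-cong f≗g zero    = refl
applyUpTo-cong f≗g (suc n) = cong₂ _∷_ (f≗g 0) (applyUpTo-cong (f≗g ∘ suc) n)

sum-applyUpTo-vanish : ∀ (f : ℕ → ℕ) L n → L ≤ n → (∀ i → L ≤ i → f i ≡ 0) →
                       sum (applyUpTo f n) ≡ sum (applyUpTo f L)
sum-applyUpTo-vanish f zero    zero    _         _   = refl
sum-applyUpTo-vanish f zero    (suc n) _         f≡0 = cong₂ _+_ (f≡0 0 z≤n)
  (sum-applyUpTo-vanish (f ∘ suc) 0 n z≤n (λ i _ → f≡0 (suc i) z≤n))
sum-applyUpTo-vanish f (suc L) (suc n) (s≤s L≤n) f≡0 = cong (f 0 +_)
  (sum-applyUpTo-vanish (f ∘ suc) L n L≤n (λ i L≤i → f≡0 (suc i) (s≤s L≤i)))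

module _ (a : ℕ) (as : List ℕ) where

  summand : ℕ → ℕ → ℕ
  summand m x = if a * x ≤ᵇ m then dℕ as (m ∸ a * x) else 0

  summand-≤ : ∀ {m x} → a * x ≤ m → summand m x ≡ dℕ as (m ∸ a * x)
  summand-≤ {m} {x} h rewrite dec-true (a * x ≤? m) h = refl

  summand-> : ∀ {m x} → m < a * x → summand m x ≡ 0
  summand-> {m} {x} h rewrite dec-false (a * x ≤? m) (<⇒≱ h) = refl

  summand-zero : ∀ m → summand m 0 ≡ dℕ as m
  summand-zero m = trans (summand-≤ (subst (_≤ m) (sym (*-zeroʳ a)) z≤n)) (cong (λ y → dℕ as (m ∸ y)) (*-zeroʳ a))

  dℕ-as-sum : ∀ m → dℕ (a ∷ as) m ≡ sum (applyUpTo (summand m) (suc m))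
  dℕ-as-sum m = cong sum (map-upTo (summand m) (suc m))

  summand-suc : ∀ {m} x → a ≤ m → summand m (suc x) ≡ summand (m ∸ a) x
  summand-suc {m} x a≤m with a * x ≤? m ∸ a
  ... | yes h = begin
    summand m (suc x)         ≡⟨ summand-≤ a[1+x]≤m ⟩
    dℕ as (m ∸ a * suc x)     ≡⟨ cong (λ y → dℕ as (m ∸ y)) (*-suc a x) ⟩
    dℕ as (m ∸ (a + a * x))   ≡⟨ cong (dℕ as) (∸-+-assoc m a (a * x)) ⟨
    dℕ as (m ∸ a ∸ a * x)     ≡⟨ summand-≤ h ⟨
    summand (m ∸ a) x         ∎
    where
    open ≡-Reasoning
    a[1+x]≤m : a * suc x ≤ m
    a[1+x]≤m = subst (_≤ m) (sym (*-suc a x)) (≤-trans (+-monoʳ-≤ a h) (≤-reflexive (m+[n∸m]≡n a≤m)))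
  ... | no h = trans (summand-> m<a[1+x]) (sym (summand-> (≰⇒> h)))
    where
    m<a[1+x] : m < a * suc x
    m<a[1+x] = subst (m <_) (sym (*-suc a x))
      (subst (_< a + a * x) (m+[n∸m]≡n a≤m) (+-monoʳ-< a (≰⇒> h)))

  summand-beyond : .{{NonZero a}} → ∀ m x → m < x → summand m x ≡ 0
  summand-beyond m x m<x = summand-> (<-≤-trans m<x (m≤n*m x a))

  dℕ-peel : .{{NonZero a}} → ∀ m → a ≤ m → dℕ (a ∷ as) m ≡ dℕ as m + dℕ (a ∷ as) (m ∸ a)
  dℕ-peel m a≤m = begin
    dℕ (a ∷ as) m
      ≡⟨ dℕ-as-sum m ⟩
    summand m 0 + sum (applyUpTo (summand m ∘ suc) m)
      ≡⟨ cong₂ _+_ (summand-zero m) (cong sum (applyUpTo-cong (λ x → summand-suc x a≤m) m)) ⟩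
    dℕ as m + sum (applyUpTo (summand (m ∸ a)) m)
      ≡⟨ cong (dℕ as m +_) (sum-applyUpTo-vanish (summand (m ∸ a)) (suc (m ∸ a)) m
           (∸-monoʳ-< (>-nonZero⁻¹ a) a≤m) (λ x → summand-beyond (m ∸ a) x)) ⟩
    dℕ as m + sum (applyUpTo (summand (m ∸ a)) (suc (m ∸ a)))
      ≡⟨ cong (dℕ as m +_) (dℕ-as-sum (m ∸ a)) ⟨
    dℕ as m + dℕ (a ∷ as) (m ∸ a)
      ∎
    where open ≡-Reasoning

  dℕ-below : .{{NonZero a}} → ∀ m → m < a → dℕ (a ∷ as) m ≡ dℕ as m
  dℕ-below m m<a = begin
    dℕ (a ∷ as) m                          ≡⟨ dℕ-as-sum m ⟩
    sum (applyUpTo (summand m) (suc m))    ≡⟨ sum-applyUpTo-vanish (summand m) 1 (suc m) (s≤s z≤n) beyond ⟩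
    summand m 0 + 0                        ≡⟨ +-identityʳ _ ⟩
    summand m 0                            ≡⟨ summand-zero m ⟩
    dℕ as m                                ∎
    where
    open ≡-Reasoning
    beyond : ∀ x → 1 ≤ x → summand m x ≡ 0
    beyond (suc x) _ = summand-> (<-≤-trans m<a (m≤m*n a (suc x)))

dℕ[]-positive : ∀ {m} → 0 < m → dℕ [] m ≡ 0
dℕ[]-positive {suc _} _ = refl

-- Division

[r+q*n]/n≡q : ∀ {r n} q .{{_ : NonZero n}} → r < n → (r + q * n) / n ≡ q
[r+q*n]/n≡q {r} {n} q r<n = begin
  (r + q * n) / n      ≡⟨ +-distrib-/-∣ʳ r (n∣m*n q) ⟩
  r / n + q * n / n    ≡⟨ cong₂ _+_ (m<n⇒m/n≡0 r<n) (m*n/n≡m q n) ⟩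
  q                    ∎
  where open ≡-Reasoning

⌈_/_⌉ : (m n : ℕ) .{{_ : NonZero n}} → ℕ
⌈ m / n ⌉ = (m + pred n) / n

module _ {n : ℕ} .{{_ : NonZero n}} where

  ⌈0/n⌉≡0 : ⌈ 0 / n ⌉ ≡ 0
  ⌈0/n⌉≡0 = m<n⇒m/n≡0 (≤-reflexive (suc-pred n))

  ⌈q*n+m/n⌉≡q+⌈m/n⌉ : ∀ q m → ⌈ q * n + m / n ⌉ ≡ q + ⌈ m / n ⌉
  ⌈q*n+m/n⌉≡q+⌈m/n⌉ q m = begin
    (q * n + m + pred n) / n              ≡⟨ cong (_/ n) (+-assoc (q * n) m (pred n)) ⟩
    (q * n + (m + pred n)) / n            ≡⟨ +-distrib-/-∣ˡ (m + pred n) (n∣m*n q) ⟩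
    q * n / n + ⌈ m / n ⌉                 ≡⟨ cong (_+ ⌈ m / n ⌉) (m*n/n≡m q n) ⟩
    q + ⌈ m / n ⌉                         ∎
    where open ≡-Reasoning

  ⌈m/n⌉≡1 : ∀ {m} → 0 < m → m ≤ n → ⌈ m / n ⌉ ≡ 1
  ⌈m/n⌉≡1 {suc m} _ m<n = trans (cong (_/ n) shift) ([r+q*n]/n≡q 1 m<n)
    where
    shift : suc m + pred n ≡ m + 1 * n
    shift = trans (sym (+-suc m (pred n))) (cong (m +_) (trans (suc-pred n) (sym (*-identityˡ n))))

  ⌈m/n⌉≡1+⌈[m∸n]/n⌉ : ∀ {m} → 0 < m → ⌈ m / n ⌉ ≡ suc ⌈ m ∸ n / n ⌉
  ⌈m/n⌉≡1+⌈[m∸n]/n⌉ {m} 0<m with n ≤? m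
  ... | yes n≤m = trans (cong ⌈_/ n ⌉ (trans (sym (m+[n∸m]≡n n≤m)) (cong (_+ (m ∸ n)) (sym (*-identityˡ n)))))
                        (⌈q*n+m/n⌉≡q+⌈m/n⌉ 1 (m ∸ n))
  ... | no n≰m = begin
    ⌈ m / n ⌉             ≡⟨ ⌈m/n⌉≡1 0<m (<⇒≤ (≰⇒> n≰m)) ⟩
    1                     ≡⟨ cong suc ⌈0/n⌉≡0 ⟨
    suc ⌈ 0 / n ⌉         ≡⟨ cong (λ k → suc ⌈ k / n ⌉) (m≤n⇒m∸n≡0 (<⇒≤ (≰⇒> n≰m))) ⟨
    suc ⌈ m ∸ n / n ⌉     ∎
    where open ≡-Reasoning

  ⌈q*n+r/n⌉≡1+q : ∀ q {r} → 0 < r → r ≤ n → ⌈ q * n + r / n ⌉ ≡ suc q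
  ⌈q*n+r/n⌉≡1+q q {r} 0<r r≤n = begin
    ⌈ q * n + r / n ⌉     ≡⟨ ⌈q*n+m/n⌉≡q+⌈m/n⌉ q r ⟩
    q + ⌈ r / n ⌉         ≡⟨ cong (q +_) (⌈m/n⌉≡1 0<r r≤n) ⟩
    q + 1                 ≡⟨ +-comm q 1 ⟩
    suc q                 ∎
    where open ≡-Reasoning

  m≡q*n+r⇒⌈m/n⌉≡1+q : ∀ {m} q {r} → m ≡ q * n + r → 0 < r → r ≤ n → ⌈ m / n ⌉ ≡ suc q
  m≡q*n+r⇒⌈m/n⌉≡1+q q m≡ 0<r r≤n = trans (cong ⌈_/ n ⌉ m≡) (⌈q*n+r/n⌉≡1+q q 0<r r≤n)

  m+e≡[1+q]*n⇒⌈m/n⌉≡1+q : ∀ m q {e} → m + e ≡ suc q * n → e < n → ⌈ m / n ⌉ ≡ suc q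
  m+e≡[1+q]*n⇒⌈m/n⌉≡1+q m q {e} m+e≡[1+q]n e<n =
    m≡q*n+r⇒⌈m/n⌉≡1+q q m≡ (m<n⇒0<n∸m e<n) (m∸n≤m n e)
    where
    open ≡-Reasoning
    m≡ : m ≡ q * n + (n ∸ e)
    m≡ = begin
      m                     ≡⟨ m+n∸n≡m m e ⟨
      m + e ∸ e             ≡⟨ cong (_∸ e) (trans m+e≡[1+q]n (+-comm n (q * n))) ⟩
      q * n + n ∸ e         ≡⟨ +-∸-assoc (q * n) (<⇒≤ e<n) ⟩
      q * n + (n ∸ e)       ∎

-- One and two generators

module SingleGenerator (C : ℕ) .{{_ : NonZero C}} where

  dℕ-single-periodic : ∀ r q → dℕ (C ∷ []) (r + q * C) ≡ dℕ (C ∷ []) r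
  dℕ-single-periodic r zero    = cong (dℕ (C ∷ [])) (+-identityʳ r)
  dℕ-single-periodic r (suc q) = begin
    dℕ (C ∷ []) (r + suc q * C)            ≡⟨ dℕ-peel C [] _ C≤m ⟩
    dℕ [] (r + suc q * C) + dℕ (C ∷ []) (r + suc q * C ∸ C)
                                           ≡⟨ cong₂ _+_ (dℕ[]-positive 0<m) (cong (dℕ (C ∷ [])) m∸C) ⟩
    dℕ (C ∷ []) (r + q * C)                ≡⟨ dℕ-single-periodic r q ⟩
    dℕ (C ∷ []) r                          ∎
    where
    open ≡-Reasoning
    C≤m : C ≤ r + suc q * C
    C≤m = ≤-trans (m≤m+n C (q * C)) (m≤n+m (suc q * C) r)
    0<m : 0 < r + suc q * C
    0<m = <-≤-trans (>-nonZero⁻¹ C) C≤m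
    m∸C : r + suc q * C ∸ C ≡ r + q * C
    m∸C = trans (cong (_∸ C) shift) (m+n∸n≡m (r + q * C) C)
      where
      shift : r + suc q * C ≡ r + q * C + C
      shift = solve (r ∷ q ∷ C ∷ [])

  dℕ-single-∣ : ∀ {m} → C ∣ m → dℕ (C ∷ []) m ≡ 1
  dℕ-single-∣ (divides-refl q) = trans (dℕ-single-periodic 0 q) (dℕ-below C [] 0 (>-nonZero⁻¹ C))

  dℕ-single-∤ : ∀ {m} → ¬ C ∣ m → dℕ (C ∷ []) m ≡ 0
  dℕ-single-∤ {m} C∤m = begin
    dℕ (C ∷ []) m                        ≡⟨ cong (dℕ (C ∷ [])) (m≡m%n+[m/n]*n m C) ⟩
    dℕ (C ∷ []) (m % C + (m / C) * C)    ≡⟨ dℕ-single-periodic (m % C) (m / C) ⟩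
    dℕ (C ∷ []) (m % C)                  ≡⟨ dℕ-below C [] (m % C) (m%n<n m C) ⟩
    dℕ [] (m % C)                        ≡⟨ dℕ[]-positive (n≢0⇒n>0 (C∤m ∘ m%n≡0⇒n∣m m C)) ⟩
    0                                    ∎
    where open ≡-Reasoning

  suc-/ : ∀ n → suc n / C ≡ dℕ (C ∷ []) (suc n) + n / C
  suc-/ n = subst (λ n → suc n / C ≡ dℕ (C ∷ []) (suc n) + n / C) (sym (m≡m%n+[m/n]*n n C))
                  (step (n % C) (n / C) (m%n<n n C))
    where
    step : ∀ r q → r < C → (suc r + q * C) / C ≡ dℕ (C ∷ []) (suc r + q * C) + (r + q * C) / C
    step r q r<C with m≤n⇒m<n∨m≡n r<C
    ... | inj₁ 1+r<C = begin
      (suc r + q * C) / C                                 ≡⟨ [r+q*n]/n≡q q 1+r<C ⟩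
      q                                                   ≡⟨ [r+q*n]/n≡q q r<C ⟨
      (r + q * C) / C                                     ≡⟨ cong (_+ (r + q * C) / C) empty ⟨
      dℕ (C ∷ []) (suc r + q * C) + (r + q * C) / C       ∎
      where
      open ≡-Reasoning
      empty : dℕ (C ∷ []) (suc r + q * C) ≡ 0
      empty = trans (dℕ-single-periodic (suc r) q) (dℕ-below C [] (suc r) 1+r<C)
    ... | inj₂ 1+r≡C = begin
      (suc r + q * C) / C
        ≡⟨ cong (_/ C) multiple ⟩
      suc q * C / C
        ≡⟨ m*n/n≡m (suc q) C ⟩
      1 + q
        ≡⟨ cong₂ _+_ (dℕ-single-∣ (divides (suc q) multiple)) ([r+q*n]/n≡q q r<C) ⟨
      dℕ (C ∷ []) (suc r + q * C) + (r + q * C) / C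
        ∎
      where
      open ≡-Reasoning
      multiple : suc r + q * C ≡ suc q * C
      multiple = cong (_+ q * C) 1+r≡C

module PairOfGenerators (B C : ℕ) .{{_ : NonZero B}} .{{_ : NonZero C}} (coprime : Coprime B C) where
  open SingleGenerator C

  dℕ-single-transfer : ∀ {X v J} → X + C * v ≡ B * J → dℕ (C ∷ []) X ≡ dℕ (C ∷ []) J
  dℕ-single-transfer {X} {v} {J} eq with C ∣? J
  ... | yes C∣J = trans (dℕ-single-∣ C∣X) (sym (dℕ-single-∣ C∣J))
    where
    C∣X : C ∣ X
    C∣X = ∣m+n∣m⇒∣n (subst (C ∣_) (trans (sym eq) (+-comm X (C * v))) (∣-trans C∣J (n∣m*n B)))
                    (m∣m*n v)
  ... | no C∤J = trans (dℕ-single-∤ C∤X) (sym (dℕ-single-∤ C∤J))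
    where
    C∤X : ¬ C ∣ X
    C∤X C∣X = C∤J (coprime-divisor (Coprimality.sym coprime)
                    (subst (C ∣_) eq (∣m∣n⇒∣m+n C∣X (m∣m*n v))))

  quotient-bound : ∀ {X v J} → X < B → v ≤ B → X + C * v ≡ B * suc J → J < C
  quotient-bound {X} {v} {J} X<B v≤B eq = s≤s⁻¹ (*-cancelˡ-< B (suc J) (suc C) (begin-strict
    B * suc J      ≡⟨ eq ⟨
    X + C * v      <⟨ +-monoˡ-< (C * v) X<B ⟩
    B + C * v      ≤⟨ +-monoʳ-≤ B (*-monoʳ-≤ C v≤B) ⟩
    B + C * B      ≡⟨ cong (B +_) (*-comm C B) ⟩
    B + B * C      ≡⟨ *-suc B C ⟨
    B * suc C      ∎))
    where open ≤-Reasoning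

  -- The solutions of B u + C v′ = X are u = J − s C, v′ = s B − v for 1 ≤ s ≤ J / C.
  dℕ-pair : ∀ {v} J X → 0 < v → v ≤ B → X + C * v ≡ B * J → dℕ (B ∷ C ∷ []) X ≡ J / C
  dℕ-pair {v} zero X 0<v _ eq =
    contradiction (trans eq (*-zeroʳ B)) (>⇒≢ (<-≤-trans 0<Cv (m≤n+m (C * v) X)))
    where
    0<Cv : 0 < C * v
    0<Cv = subst (_< C * v) (*-zeroʳ C) (*-monoʳ-< C 0<v)
  dℕ-pair {v} (suc J) X 0<v v≤B eq = begin
    dℕ (B ∷ C ∷ []) X                 ≡⟨ peel-or-below ⟩
    dℕ (C ∷ []) X + J / C             ≡⟨ cong (_+ J / C) (dℕ-single-transfer eq) ⟩
    dℕ (C ∷ []) (suc J) + J / C       ≡⟨ suc-/ J ⟨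
    suc J / C                         ∎
    where
    open ≡-Reasoning
    peel-or-below : dℕ (B ∷ C ∷ []) X ≡ dℕ (C ∷ []) X + J / C
    peel-or-below with B ≤? X
    ... | yes B≤X = trans (dℕ-peel B (C ∷ []) X B≤X)
                          (cong (dℕ (C ∷ []) X +_) (dℕ-pair J (X ∸ B) 0<v v≤B eq′))
      where
      eq′ : X ∸ B + C * v ≡ B * J
      eq′ = begin
        X ∸ B + C * v     ≡⟨ +-∸-comm (C * v) B≤X ⟨
        X + C * v ∸ B     ≡⟨ cong (_∸ B) (trans eq (*-suc B J)) ⟩
        B + B * J ∸ B     ≡⟨ m+n∸m≡n B (B * J) ⟩
        B * J             ∎
    ... | no B≰X = begin
      dℕ (B ∷ C ∷ []) X       ≡⟨ dℕ-below B (C ∷ []) X (≰⇒> B≰X) ⟩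
      dℕ (C ∷ []) X           ≡⟨ +-identityʳ _ ⟨
      dℕ (C ∷ []) X + 0       ≡⟨ cong (dℕ (C ∷ []) X +_) (m<n⇒m/n≡0 (quotient-bound (≰⇒> B≰X) v≤B eq)) ⟨
      dℕ (C ∷ []) X + J / C   ∎

  dℕ-pair₁ : ∀ {J X} → X + C ≡ B * J → dℕ (B ∷ C ∷ []) X ≡ J / C
  dℕ-pair₁ {J} {X} eq = dℕ-pair J X (s≤s z≤n) (>-nonZero⁻¹ B) (trans (cong (X +_) (*-identityʳ C)) eq)

  bézout : ∃₂ λ y w → 1 + y * C ≡ w * B
  bézout with coprime-Bézout coprime
  ... | Bézout.+- w y eq = y , w , eq
  ... | Bézout.-+ x y eq = β * y , suc (β * x) , (begin
    1 + β * y * C                ≡⟨ cong (1 +_) (*-assoc β y C) ⟩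
    1 + β * (y * C)              ≡⟨ cong (λ z → 1 + β * z) eq ⟨
    1 + β * (1 + x * B)          ≡⟨ cong (λ z → 1 + β * (1 + x * z)) (suc-pred B) ⟨
    1 + β * (1 + x * suc β)      ≡⟨ expand β ⟩
    suc (β * x) * suc β          ≡⟨ cong (suc (β * x) *_) (suc-pred B) ⟩
    suc (β * x) * B              ∎)
    where
    open ≡-Reasoning
    β : ℕ
    β = pred B
    expand : ∀ b′ → 1 + b′ * (1 + x * suc b′) ≡ suc (b′ * x) * suc b′
    expand b′ = solve (b′ ∷ x ∷ [])

  record Residue (M : ℕ) : Set where
    field
      v J   : ℕ
      0<v   : 0 < v
      v≤B   : v ≤ B
      M+Cv≡BJ : M + C * v ≡ B * J

  -- Bézout yields some v ≥ 1; subtracting B from v and C from J brings v into [1, B].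
  residue : ∀ M → Residue M
  residue M with bézout
  ... | y , w , eq = <-rec (λ v → ∀ {J} → 0 < v → M + C * v ≡ B * J → Residue M)
                          reduce (y * M + B) 0<v₀ start
    where
    0<v₀ : 0 < y * M + B
    0<v₀ = <-≤-trans (>-nonZero⁻¹ B) (m≤n+m B (y * M))
    start : M + C * (y * M + B) ≡ B * (w * M + C)
    start = begin
      M + C * (y * M + B)      ≡⟨ solve (M ∷ C ∷ y ∷ B ∷ []) ⟩
      M * (1 + y * C) + C * B  ≡⟨ cong (λ z → M * z + C * B) eq ⟩
      M * (w * B) + C * B      ≡⟨ solve (M ∷ w ∷ B ∷ C ∷ []) ⟩
      B * (w * M + C)          ∎
      where open ≡-Reasoning
    reduce : ∀ v → (∀ {u} → u < v → ∀ {J} → 0 < u → M + C * u ≡ B * J → Residue M) →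
             ∀ {J} → 0 < v → M + C * v ≡ B * J → Residue M
    reduce v rec {J} 0<v eq′ with v ≤? B
    ... | yes v≤B = record { v = v ; J = J ; 0<v = 0<v ; v≤B = v≤B ; M+Cv≡BJ = eq′ }
    ... | no v≰B = rec (∸-monoʳ-< (>-nonZero⁻¹ B) (<⇒≤ B<v)) (m<n⇒0<n∸m B<v) (begin
      M + C * (v ∸ B)          ≡⟨ cong (M +_) (*-distribˡ-∸ C v B) ⟩
      M + (C * v ∸ C * B)      ≡⟨ +-∸-assoc M (*-monoʳ-≤ C (<⇒≤ B<v)) ⟨
      M + C * v ∸ C * B        ≡⟨ cong₂ _∸_ eq′ (*-comm C B) ⟩
      B * J ∸ B * C            ≡⟨ *-distribˡ-∸ B J C ⟨
      B * (J ∸ C)              ∎)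
      where
      open ≡-Reasoning
      B<v : B < v
      B<v = ≰⇒> v≰B

  representations-above : ∀ x {M v J} → 0 < v → v ≤ B → M + C * v ≡ B * J →
                          suc x * (B * C) < M + (B + C) → x < dℕ (B ∷ C ∷ []) M
  representations-above x {M} {v} {J} 0<v v≤B M+Cv≡BJ bound =
    subst (x <_) (sym (dℕ-pair J M 0<v v≤B M+Cv≡BJ))
      (subst (_≤ J / C) (m*n/n≡m (suc x) C) (/-monoˡ-≤ C (s≤s⁻¹ (*-cancelˡ-< B _ _ (begin-strict
        B * (suc x * C)    ≡⟨ solve (B ∷ x ∷ C ∷ []) ⟩
        suc x * (B * C)    <⟨ bound ⟩
        M + (B + C)        ≤⟨ +-monoʳ-≤ M (+-monoʳ-≤ B C≤Cv) ⟩
        M + (B + C * v)    ≡⟨ solve (M ∷ B ∷ C ∷ v ∷ []) ⟩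
        M + C * v + B      ≡⟨ cong (_+ B) M+Cv≡BJ ⟩
        B * J + B          ≡⟨ solve (B ∷ J ∷ []) ⟩
        B * suc J          ∎)))))
    where
    open ≤-Reasoning
    C≤Cv : C ≤ C * v
    C≤Cv = subst (_≤ C * v) (*-identityʳ C) (*-monoʳ-≤ C 0<v)

  frobenius-above : ∀ x M → suc x * (B * C) < M + (B + C) → x < dℕ (B ∷ C ∷ []) M
  frobenius-above x M = representations-above x 0<v v≤B M+Cv≡BJ
    where open Residue (residue M)

  frob : ℕ
  frob = B * C ∸ (B + C)

  module _ (B+C≤BC : B + C ≤ B * C) where

    frob+B+C≡BC : frob + (B + C) ≡ B * C
    frob+B+C≡BC = m∸n+n≡m B+C≤BC

    frob-level : ∀ Q → frob + B * Q + C ≡ B * (Q + pred C)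
    frob-level Q = +-cancelʳ-≡ B _ _ (begin
      frob + B * Q + C + B             ≡⟨ rearrange frob ⟩
      frob + (B + C) + B * Q           ≡⟨ cong (_+ B * Q) frob+B+C≡BC ⟩
      B * C + B * Q                    ≡⟨ cong (λ c → B * c + B * Q) (suc-pred C) ⟨
      B * suc (pred C) + B * Q         ≡⟨ collect (pred C) ⟩
      B * (Q + pred C) + B             ∎)
      where
      open ≡-Reasoning
      rearrange : ∀ f → f + B * Q + C + B ≡ f + (B + C) + B * Q
      rearrange f = solve (f ∷ B ∷ Q ∷ C ∷ [])
      collect : ∀ c → B * suc c + B * Q ≡ B * (Q + c) + B
      collect c = solve (B ∷ c ∷ Q ∷ [])

    dℕ-pair-above-frob : ∀ Q → dℕ (B ∷ C ∷ []) (frob + B * Q) ≡ ⌈ Q / C ⌉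
    dℕ-pair-above-frob Q = dℕ-pair₁ (frob-level Q)

    frobenius : ∀ x → IsGFrob (B ∷ C ∷ []) x (ℤ.+ (frob + B * (x * C)))
    frobenius x = ≤-reflexive exact , above
      where
      exact : dℕ (B ∷ C ∷ []) (frob + B * (x * C)) ≡ x
      exact = begin
        dℕ (B ∷ C ∷ []) (frob + B * (x * C))   ≡⟨ dℕ-pair-above-frob (x * C) ⟩
        ⌈ x * C / C ⌉                          ≡⟨ cong ⌈_/ C ⌉ (+-identityʳ (x * C)) ⟨
        ⌈ x * C + 0 / C ⌉                      ≡⟨ ⌈q*n+m/n⌉≡q+⌈m/n⌉ x 0 ⟩
        x + ⌈ 0 / C ⌉                          ≡⟨ cong (x +_) ⌈0/n⌉≡0 ⟩
        x + 0                                  ≡⟨ +-identityʳ x ⟩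
        x                                      ∎
        where open ≡-Reasoning
      above : ∀ m′ → ℤ.+ (frob + B * (x * C)) ℤ.< m′ → x < d m′ (B ∷ C ∷ [])
      above (ℤ.+ M) (ℤ.+<+ frob′<M) = frobenius-above x M (begin-strict
        suc x * (B * C)                  ≡⟨ split ⟩
        B * C + B * (x * C)              ≡⟨ cong (_+ B * (x * C)) frob+B+C≡BC ⟨
        frob + (B + C) + B * (x * C)     ≡⟨ swap frob ⟩
        frob + B * (x * C) + (B + C)     <⟨ +-monoˡ-< (B + C) frob′<M ⟩
        M + (B + C)                      ∎)
        where
        open ≤-Reasoning
        split : suc x * (B * C) ≡ B * C + B * (x * C)
        split = solve (x ∷ B ∷ C ∷ [])
        swap : ∀ f → f + (B + C) + B * (x * C) ≡ f + B * (x * C) + (B + C)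
        swap f = solve (f ∷ B ∷ C ∷ x ∷ [])

-- Adding the generator p B

module ThreeGenerators (B C p : ℕ) .{{_ : NonZero B}} .{{_ : NonZero C}} .{{_ : NonZero p}}
                       (coprime : Coprime B C) (B+C≤BC : B + C ≤ B * C) where
  open PairOfGenerators B C coprime

  instance
    pB≢0 : NonZero (p * B)
    pB≢0 = m*n≢0 p B

  triple : ℕ → ℕ
  triple = dℕ (p * B ∷ B ∷ C ∷ [])

  triple-peel : ∀ {J X} → X + C ≡ B * J → p * B ≤ X →
                triple X ≡ J / C + triple (X ∸ p * B) × (X ∸ p * B) + C ≡ B * (J ∸ p)
  triple-peel {J} {X} eq pB≤X = trans (dℕ-peel (p * B) (B ∷ C ∷ []) X pB≤X)
                                      (cong (_+ triple (X ∸ p * B)) (dℕ-pair₁ eq))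
                              , (begin
    X ∸ p * B + C      ≡⟨ +-∸-comm C pB≤X ⟨
    X + C ∸ p * B      ≡⟨ cong₂ _∸_ eq (*-comm p B) ⟩
    B * J ∸ B * p      ≡⟨ *-distribˡ-∸ B J p ⟨
    B * (J ∸ p)        ∎)
    where open ≡-Reasoning

  triple-vanish : ∀ J {X} → X + C ≡ B * J → J < C → triple X ≡ 0
  triple-vanish = <-rec (λ J → ∀ {X} → X + C ≡ B * J → J < C → triple X ≡ 0) vanish
    where
    vanish : ∀ J → (∀ {J′} → J′ < J → ∀ {X} → X + C ≡ B * J′ → J′ < C → triple X ≡ 0) →
             ∀ {X} → X + C ≡ B * J → J < C → triple X ≡ 0
    vanish zero _ {X} eq _ = contradiction (trans eq (*-zeroʳ B)) (>⇒≢ (<-≤-trans (>-nonZero⁻¹ C) (m≤n+m C X)))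
    vanish (suc J) rec {X} eq J<C with p * B ≤? X
    ... | yes pB≤X = let (peel , eq′) = triple-peel eq pB≤X in begin
      triple X
        ≡⟨ peel ⟩
      suc J / C + triple (X ∸ p * B)
        ≡⟨ cong₂ _+_ (m<n⇒m/n≡0 J<C) (rec J′<J eq′ (≤-<-trans (m∸n≤m (suc J) p) J<C)) ⟩
      0
        ∎
      where
      open ≡-Reasoning
      J′<J : suc J ∸ p < suc J
      J′<J = s≤s (∸-monoʳ-≤ (suc J) (>-nonZero⁻¹ p))
    ... | no pB≰X = trans (dℕ-below (p * B) (B ∷ C ∷ []) X (≰⇒> pB≰X))
                          (trans (dℕ-pair₁ eq) (m<n⇒m/n≡0 J<C))

  triple-small : ∀ {J X} → X + C ≡ B * J → J < p + C → triple X ≡ J / C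
  triple-small {J} {X} eq J<p+C with p * B ≤? X
  ... | yes pB≤X = let (peel , eq′) = triple-peel eq pB≤X in begin
    triple X                          ≡⟨ peel ⟩
    J / C + triple (X ∸ p * B)        ≡⟨ cong (J / C +_) (triple-vanish (J ∸ p) eq′ (m<n+o⇒m∸n<o J p J<p+C)) ⟩
    J / C + 0                         ≡⟨ +-identityʳ _ ⟩
    J / C                             ∎
    where open ≡-Reasoning
  ... | no pB≰X = trans (dℕ-below (p * B) (B ∷ C ∷ []) X (≰⇒> pB≰X)) (dℕ-pair₁ eq)

  Λ : ℕ → ℕ
  Λ Q = triple (frob + B * Q)

  Λ-zero : Λ 0 ≡ 0
  Λ-zero = triple-vanish (0 + pred C) (frob-level B+C≤BC 0) (≤-reflexive (suc-pred C))

  Λ-step : ∀ Q → Λ Q ≡ ⌈ Q / C ⌉ + Λ (Q ∸ p)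
  Λ-step Q with p ≤? Q
  ... | yes p≤Q = let (peel , _) = triple-peel (frob-level B+C≤BC Q) pB≤X in begin
    triple (frob + B * Q)                             ≡⟨ peel ⟩
    ⌈ Q / C ⌉ + triple (frob + B * Q ∸ p * B)         ≡⟨ cong (λ X → ⌈ Q / C ⌉ + triple X) shift ⟩
    ⌈ Q / C ⌉ + triple (frob + B * (Q ∸ p))           ∎
    where
    open ≡-Reasoning
    pB≤BQ : p * B ≤ B * Q
    pB≤BQ = subst (_≤ B * Q) (*-comm B p) (*-monoʳ-≤ B p≤Q)
    pB≤X : p * B ≤ frob + B * Q
    pB≤X = ≤-trans pB≤BQ (m≤n+m (B * Q) frob)
    shift : frob + B * Q ∸ p * B ≡ frob + B * (Q ∸ p)
    shift = begin
      frob + B * Q ∸ p * B      ≡⟨ +-∸-assoc frob pB≤BQ ⟩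
      frob + (B * Q ∸ p * B)    ≡⟨ cong (λ z → frob + (B * Q ∸ z)) (*-comm p B) ⟩
      frob + (B * Q ∸ B * p)    ≡⟨ cong (frob +_) (*-distribˡ-∸ B Q p) ⟨
      frob + B * (Q ∸ p)        ∎
  ... | no p≰Q = begin
    triple (frob + B * Q)          ≡⟨ triple-small (frob-level B+C≤BC Q) Q+pred[C]<p+C ⟩
    ⌈ Q / C ⌉                      ≡⟨ +-identityʳ _ ⟨
    ⌈ Q / C ⌉ + 0                  ≡⟨ cong (⌈ Q / C ⌉ +_) Λ-zero ⟨
    ⌈ Q / C ⌉ + Λ 0                ≡⟨ cong (λ z → ⌈ Q / C ⌉ + Λ z) (m≤n⇒m∸n≡0 (<⇒≤ (≰⇒> p≰Q))) ⟨
    ⌈ Q / C ⌉ + Λ (Q ∸ p)          ∎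
    where
    open ≡-Reasoning
    Q+pred[C]<p+C : Q + pred C < p + C
    Q+pred[C]<p+C = +-mono-<-≤ (≰⇒> p≰Q) pred[n]≤n

  shifted-frobenius : ∀ x y {s} → Λ (x * C + y * p) ≡ s →
         Σ ℤ λ g → IsGFrob (B ∷ C ∷ []) x g × d (g ℤ.+ ℤ.+ (y * (p * B))) (p * B ∷ B ∷ C ∷ []) ≡ s
  shifted-frobenius x y Λ≡s =
    ℤ.+ (frob + B * (x * C)) , frobenius B+C≤BC x , trans (cong triple (regroup frob)) Λ≡s
    where
    regroup : ∀ f → f + B * (x * C) + y * (p * B) ≡ f + B * (x * C + y * p)
    regroup f = solve (f ∷ B ∷ x ∷ C ∷ y ∷ p ∷ [])

-- Counting lattice points below a line

-- f Q stands for the number of (a, z) ∈ ℕ² with a C + z p < Q; only these two properties are used.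
module LatticeRecurrence (C p : ℕ) .{{_ : NonZero C}} .{{_ : NonZero p}}
                         (f : ℕ → ℕ) (f-zero : f 0 ≡ 0)
                         (f-stepC : ∀ Q → f Q ≡ ⌈ Q / C ⌉ + f (Q ∸ p)) where

  f-stepP : ∀ Q → f Q ≡ ⌈ Q / p ⌉ + f (Q ∸ C)
  f-stepP = <-rec (λ Q → f Q ≡ ⌈ Q / p ⌉ + f (Q ∸ C)) swap
    where
    interchange : ∀ a b c → suc a + (b + c) ≡ suc b + (a + c)
    interchange = solve-∀
    swap : ∀ Q → (∀ {Q′} → Q′ < Q → f Q′ ≡ ⌈ Q′ / p ⌉ + f (Q′ ∸ C)) → f Q ≡ ⌈ Q / p ⌉ + f (Q ∸ C)
    swap zero _ = sym (cong₂ _+_ ⌈0/n⌉≡0 (cong f (0∸n≡0 C)))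
    swap Q@(suc _) rec = begin
      f Q
        ≡⟨ f-stepC Q ⟩
      ⌈ Q / C ⌉ + f (Q ∸ p)
        ≡⟨ cong₂ _+_ (⌈m/n⌉≡1+⌈[m∸n]/n⌉ z<s) (rec Q∸p<Q) ⟩
      suc ⌈ Q ∸ C / C ⌉ + (⌈ Q ∸ p / p ⌉ + f (Q ∸ p ∸ C))
        ≡⟨ cong (λ z → suc ⌈ Q ∸ C / C ⌉ + (⌈ Q ∸ p / p ⌉ + f z)) ∸-comm ⟩
      suc ⌈ Q ∸ C / C ⌉ + (⌈ Q ∸ p / p ⌉ + f (Q ∸ C ∸ p))
        ≡⟨ interchange ⌈ Q ∸ C / C ⌉ ⌈ Q ∸ p / p ⌉ (f (Q ∸ C ∸ p)) ⟩
      suc ⌈ Q ∸ p / p ⌉ + (⌈ Q ∸ C / C ⌉ + f (Q ∸ C ∸ p))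
        ≡⟨ cong₂ _+_ (⌈m/n⌉≡1+⌈[m∸n]/n⌉ z<s) (f-stepC (Q ∸ C)) ⟨
      ⌈ Q / p ⌉ + f (Q ∸ C)
        ∎
      where
      open ≡-Reasoning
      Q∸p<Q : Q ∸ p < Q
      Q∸p<Q = s≤s (∸-monoʳ-≤ Q (>-nonZero⁻¹ p))
      ∸-comm : Q ∸ p ∸ C ≡ Q ∸ C ∸ p
      ∸-comm = trans (∸-+-assoc Q p C) (trans (cong (Q ∸_) (+-comm p C)) (sym (∸-+-assoc Q C p)))

  f-stepP-multiple : ∀ x → f (suc x * C) ≡ ⌈ suc x * C / p ⌉ + f (x * C)
  f-stepP-multiple x = trans (f-stepP (suc x * C)) (cong (λ z → ⌈ suc x * C / p ⌉ + f z) (m+n∸m≡n C (x * C)))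

  f-stepC-multiple : ∀ y → f (suc y * p) ≡ ⌈ suc y * p / C ⌉ + f (y * p)
  f-stepC-multiple y = trans (f-stepC (suc y * p)) (cong (λ z → ⌈ suc y * p / C ⌉ + f z) (m+n∸m≡n p (y * p)))

  f-split : ∀ x y → f (x * C + y * p) ≡ x * y + f (x * C) + f (y * p)
  f-split x zero = begin
    f (x * C + 0)               ≡⟨ cong f (+-identityʳ (x * C)) ⟩
    f (x * C)                   ≡⟨ +-identityʳ (f (x * C)) ⟨
    0 + f (x * C) + 0           ≡⟨ cong₂ (λ a b → a + f (x * C) + b) (*-zeroʳ x) f-zero ⟨
    x * 0 + f (x * C) + f 0     ∎
    where open ≡-Reasoning
  f-split x (suc y) = begin
    f (x * C + suc y * p)
      ≡⟨ f-stepC _ ⟩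
    ⌈ x * C + suc y * p / C ⌉ + f (x * C + suc y * p ∸ p)
      ≡⟨ cong₂ _+_ (⌈q*n+m/n⌉≡q+⌈m/n⌉ x (suc y * p)) (cong f drop-p) ⟩
    x + ⌈ suc y * p / C ⌉ + f (x * C + y * p)
      ≡⟨ cong (x + ⌈ suc y * p / C ⌉ +_) (f-split x y) ⟩
    x + ⌈ suc y * p / C ⌉ + (x * y + f (x * C) + f (y * p))
      ≡⟨ regroup x y _ _ _ ⟩
    x * suc y + f (x * C) + (⌈ suc y * p / C ⌉ + f (y * p))
      ≡⟨ cong (x * suc y + f (x * C) +_) (f-stepC-multiple y) ⟨
    x * suc y + f (x * C) + f (suc y * p)
      ∎
    where
    open ≡-Reasoning
    drop-p : x * C + suc y * p ∸ p ≡ x * C + y * p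
    drop-p = trans (cong (_∸ p) shift) (m+n∸n≡m (x * C + y * p) p)
      where
      shift : x * C + suc y * p ≡ x * C + y * p + p
      shift = solve (x ∷ C ∷ y ∷ p ∷ [])
    regroup : ∀ x y a b c → x + a + (x * y + b + c) ≡ x * suc y + b + (a + c)
    regroup = solve-∀

module EvenLattice (m : ℕ) .{{_ : NonZero m}} (f : ℕ → ℕ) (f-zero : f 0 ≡ 0)
                   (f-stepC : ∀ Q → f Q ≡ ⌈ Q / 3 + 2 * m ⌉ + f (Q ∸ m)) where
  open LatticeRecurrence (3 + 2 * m) m f f-zero f-stepC public

  f-multiples-C : ∀ x → 3 * x ≤ m → f (x * (3 + 2 * m)) ≡ x * (x + 2)
  f-multiples-C zero    _      = f-zero
  f-multiples-C (suc x) 3x′≤m = begin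
    f (suc x * (3 + 2 * m))
      ≡⟨ f-stepP-multiple x ⟩
    ⌈ suc x * (3 + 2 * m) / m ⌉ + f (x * (3 + 2 * m))
      ≡⟨ cong₂ _+_ ceiling (f-multiples-C x (≤-trans (*-monoʳ-≤ 3 (n≤1+n x)) 3x′≤m)) ⟩
    suc (2 * suc x) + x * (x + 2)
      ≡⟨ solve (x ∷ []) ⟩
    suc x * (suc x + 2)
      ∎
    where
    open ≡-Reasoning
    ceiling : ⌈ suc x * (3 + 2 * m) / m ⌉ ≡ suc (2 * suc x)
    ceiling = m≡q*n+r⇒⌈m/n⌉≡1+q (2 * suc x) split (s≤s z≤n) 3x′≤m
      where
      split : suc x * (3 + 2 * m) ≡ 2 * suc x * m + 3 * suc x
      split = solve (x ∷ m ∷ [])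

  f-even-multiples-p : ∀ l → 3 * l < m + 3 → f (2 * l * m) ≡ l * suc l
  f-odd-multiples-p  : ∀ l → 3 * l < m → f (suc (2 * l) * m) ≡ suc l * suc l

  f-even-multiples-p zero    _        = f-zero
  f-even-multiples-p (suc l) 3l′<m+3 = begin
    f (2 * suc l * m)                                        ≡⟨ cong (λ z → f (z * m)) (*-suc 2 l) ⟩
    f (suc (suc (2 * l)) * m)                                ≡⟨ f-stepC-multiple (suc (2 * l)) ⟩
    ⌈ suc (suc (2 * l)) * m / 3 + 2 * m ⌉ + f (suc (2 * l) * m)
                                                             ≡⟨ cong₂ _+_ ceiling (f-odd-multiples-p l 3l<m) ⟩
    suc l + suc l * suc l                                    ≡⟨ solve (l ∷ []) ⟩
    suc l * suc (suc l)                                      ∎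
    where
    open ≡-Reasoning
    3l<m : 3 * l < m
    3l<m = +-cancelʳ-< 3 (3 * l) m (subst (_< m + 3) (trans (*-suc 3 l) (+-comm 3 (3 * l))) 3l′<m+3)
    ceiling : ⌈ suc (suc (2 * l)) * m / 3 + 2 * m ⌉ ≡ suc l
    ceiling = m+e≡[1+q]*n⇒⌈m/n⌉≡1+q (suc (suc (2 * l)) * m) l split
      (subst (_< 3 + 2 * m) (sym (*-suc 3 l)) (+-monoʳ-< 3 (<-≤-trans 3l<m (m≤m+n m (m + 0)))))
      where
      split : suc (suc (2 * l)) * m + 3 * suc l ≡ suc l * (3 + 2 * m)
      split = solve (l ∷ m ∷ [])

  f-odd-multiples-p l 3l<m = begin
    f (suc (2 * l) * m)
      ≡⟨ f-stepC-multiple (2 * l) ⟩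
    ⌈ suc (2 * l) * m / 3 + 2 * m ⌉ + f (2 * l * m)
      ≡⟨ cong₂ _+_ ceiling (f-even-multiples-p l (≤-trans 3l<m (m≤m+n m 3))) ⟩
    suc l + l * suc l
      ≡⟨ solve (l ∷ []) ⟩
    suc l * suc l
      ∎
    where
    open ≡-Reasoning
    ceiling : ⌈ suc (2 * l) * m / 3 + 2 * m ⌉ ≡ suc l
    ceiling = m+e≡[1+q]*n⇒⌈m/n⌉≡1+q (suc (2 * l) * m) l split
      (subst₂ _<_ reorder double (+-monoʳ-< 3 (+-monoʳ-< m 3l<m)))
      where
      split : suc (2 * l) * m + (m + 3 * suc l) ≡ suc l * (3 + 2 * m)
      split = solve (l ∷ m ∷ [])
      reorder : 3 + (m + 3 * l) ≡ m + 3 * suc l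
      reorder = solve (m ∷ l ∷ [])
      double : 3 + (m + m) ≡ 3 + 2 * m
      double = solve (m ∷ [])

  f-lower : ∀ i d → 3 * i ≤ m → 3 * d < m + 3 →
            f (i * (3 + 2 * m) + 2 * d * m) ≡ (i + d) * (i + d + 1) + i
  f-lower i d 3i≤m 3d<m+3 = begin
    f (i * (3 + 2 * m) + 2 * d * m)
      ≡⟨ f-split i (2 * d) ⟩
    i * (2 * d) + f (i * (3 + 2 * m)) + f (2 * d * m)
      ≡⟨ cong₂ (λ a b → i * (2 * d) + a + b) (f-multiples-C i 3i≤m) (f-even-multiples-p d 3d<m+3) ⟩
    i * (2 * d) + i * (i + 2) + d * suc d
      ≡⟨ solve (i ∷ d ∷ []) ⟩
    (i + d) * (i + d + 1) + i
      ∎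
    where open ≡-Reasoning

  f-upper : ∀ e d → 3 * (e + d) < m →
            f (e * (3 + 2 * m) + suc (2 * d) * m) ≡ (e + d) * (e + d + 1) + (suc (e + d) + e)
  f-upper e d 3k<m = begin
    f (e * (3 + 2 * m) + suc (2 * d) * m)
      ≡⟨ f-split e (suc (2 * d)) ⟩
    e * suc (2 * d) + f (e * (3 + 2 * m)) + f (suc (2 * d) * m)
      ≡⟨ cong₂ (λ a b → e * suc (2 * d) + a + b) (f-multiples-C e 3e≤m) (f-odd-multiples-p d 3d<m) ⟩
    e * suc (2 * d) + e * (e + 2) + suc d * suc d
      ≡⟨ solve (e ∷ d ∷ []) ⟩
    (e + d) * (e + d + 1) + (suc (e + d) + e)
      ∎
    where
    open ≡-Reasoning
    3e≤m : 3 * e ≤ m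
    3e≤m = ≤-trans (*-monoʳ-≤ 3 (m≤m+n e d)) (<⇒≤ 3k<m)
    3d<m : 3 * d < m
    3d<m = ≤-<-trans (*-monoʳ-≤ 3 (m≤n+m d e)) 3k<m

module OddLattice (m : ℕ) .{{_ : NonZero m}} (f : ℕ → ℕ) (f-zero : f 0 ≡ 0)
                  (f-stepC : ∀ Q → f Q ≡ ⌈ Q / 2 + m ⌉ + f (Q ∸ (1 + 2 * m))) where
  open LatticeRecurrence (2 + m) (1 + 2 * m) f f-zero f-stepC public

  f-multiples-p : ∀ y → 3 * y < 2 + m → f (y * (1 + 2 * m)) ≡ y * suc y
  f-multiples-p zero    _          = f-zero
  f-multiples-p (suc y) 3y′<2+m = begin
    f (suc y * (1 + 2 * m))
      ≡⟨ f-stepC-multiple y ⟩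
    ⌈ suc y * (1 + 2 * m) / 2 + m ⌉ + f (y * (1 + 2 * m))
      ≡⟨ cong₂ _+_ ceiling (f-multiples-p y (≤-<-trans (*-monoʳ-≤ 3 (n≤1+n y)) 3y′<2+m)) ⟩
    suc (suc (2 * y)) + y * suc y
      ≡⟨ solve (y ∷ []) ⟩
    suc y * suc (suc y)
      ∎
    where
    open ≡-Reasoning
    ceiling : ⌈ suc y * (1 + 2 * m) / 2 + m ⌉ ≡ suc (suc (2 * y))
    ceiling = m+e≡[1+q]*n⇒⌈m/n⌉≡1+q (suc y * (1 + 2 * m)) (suc (2 * y)) split 3y′<2+m
      where
      split : suc y * (1 + 2 * m) + 3 * suc y ≡ suc (suc (2 * y)) * (2 + m)
      split = solve (y ∷ m ∷ [])

  f-even-multiples-C : ∀ l → 3 * l ≤ 2 + m → f (2 * l * (2 + m)) ≡ l * (l + 2)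
  f-odd-multiples-C  : ∀ l → 3 * suc l ≤ 2 + m → f (suc (2 * l) * (2 + m)) ≡ suc l * suc l + l

  f-even-multiples-C zero    _          = f-zero
  f-even-multiples-C (suc l) 3l′≤2+m = begin
    f (2 * suc l * (2 + m))                                            ≡⟨ cong (λ z → f (z * (2 + m))) (*-suc 2 l) ⟩
    f (suc (suc (2 * l)) * (2 + m))                                    ≡⟨ f-stepP-multiple (suc (2 * l)) ⟩
    ⌈ suc (suc (2 * l)) * (2 + m) / 1 + 2 * m ⌉ + f (suc (2 * l) * (2 + m))
                                                                       ≡⟨ cong₂ _+_ ceiling (f-odd-multiples-C l 3l′≤2+m) ⟩
    suc (suc l) + (suc l * suc l + l)                                  ≡⟨ solve (l ∷ []) ⟩
    suc l * (suc l + 2)                                                ∎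
    where
    open ≡-Reasoning
    2+m≤1+2m : 2 + m ≤ 1 + 2 * m
    2+m≤1+2m = subst₂ _≤_ (+-comm (1 + m) 1) double (+-monoʳ-≤ (1 + m) (>-nonZero⁻¹ m))
      where
      double : 1 + m + m ≡ 1 + 2 * m
      double = solve (m ∷ [])
    ceiling : ⌈ suc (suc (2 * l)) * (2 + m) / 1 + 2 * m ⌉ ≡ suc (suc l)
    ceiling = m≡q*n+r⇒⌈m/n⌉≡1+q (suc l) split (s≤s z≤n) (≤-trans 3l′≤2+m 2+m≤1+2m)
      where
      split : suc (suc (2 * l)) * (2 + m) ≡ suc l * (1 + 2 * m) + 3 * suc l
      split = solve (l ∷ m ∷ [])

  f-odd-multiples-C l 3l′≤2+m = begin
    f (suc (2 * l) * (2 + m))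
      ≡⟨ f-stepP-multiple (2 * l) ⟩
    ⌈ suc (2 * l) * (2 + m) / 1 + 2 * m ⌉ + f (2 * l * (2 + m))
      ≡⟨ cong₂ _+_ ceiling (f-even-multiples-C l (≤-trans (*-monoʳ-≤ 3 (n≤1+n l)) 3l′≤2+m)) ⟩
    suc l + l * (l + 2)
      ≡⟨ solve (l ∷ []) ⟩
    suc l * suc l + l
      ∎
    where
    open ≡-Reasoning
    remainder≤ : 2 + m + 3 * l ≤ 1 + 2 * m
    remainder≤ = +-cancelʳ-≤ 3 _ _ (subst₂ _≤_ reorder double (+-monoʳ-≤ (2 + m) 3l′≤2+m))
      where
      reorder : 2 + m + 3 * suc l ≡ 2 + m + 3 * l + 3
      reorder = solve (m ∷ l ∷ [])
      double : 2 + m + (2 + m) ≡ 1 + 2 * m + 3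
      double = solve (m ∷ [])
    ceiling : ⌈ suc (2 * l) * (2 + m) / 1 + 2 * m ⌉ ≡ suc l
    ceiling = m≡q*n+r⇒⌈m/n⌉≡1+q l split (s≤s z≤n) remainder≤
      where
      split : suc (2 * l) * (2 + m) ≡ l * (1 + 2 * m) + (2 + m + 3 * l)
      split = solve (l ∷ m ∷ [])

  f-lower : ∀ i d → 3 * i ≤ 2 + m → 3 * d < 2 + m →
            f (2 * i * (2 + m) + d * (1 + 2 * m)) ≡ (i + d) * (i + d + 1) + i
  f-lower i d 3i≤2+m 3d<2+m = begin
    f (2 * i * (2 + m) + d * (1 + 2 * m))
      ≡⟨ f-split (2 * i) d ⟩
    2 * i * d + f (2 * i * (2 + m)) + f (d * (1 + 2 * m))
      ≡⟨ cong₂ (λ a b → 2 * i * d + a + b) (f-even-multiples-C i 3i≤2+m) (f-multiples-p d 3d<2+m) ⟩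
    2 * i * d + i * (i + 2) + d * suc d
      ≡⟨ solve (i ∷ d ∷ []) ⟩
    (i + d) * (i + d + 1) + i
      ∎
    where open ≡-Reasoning

  f-upper : ∀ e d → 3 * suc e ≤ 2 + m → 3 * d < 2 + m →
            f (suc (2 * e) * (2 + m) + d * (1 + 2 * m)) ≡ (e + d) * (e + d + 1) + (suc (e + d) + e)
  f-upper e d 3e′≤2+m 3d<2+m = begin
    f (suc (2 * e) * (2 + m) + d * (1 + 2 * m))
      ≡⟨ f-split (suc (2 * e)) d ⟩
    suc (2 * e) * d + f (suc (2 * e) * (2 + m)) + f (d * (1 + 2 * m))
      ≡⟨ cong₂ (λ a b → suc (2 * e) * d + a + b) (f-odd-multiples-C e 3e′≤2+m) (f-multiples-p d 3d<2+m) ⟩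
    suc (2 * e) * d + (suc e * suc e + e) + d * suc d
      ≡⟨ solve (e ∷ d ∷ []) ⟩
    (e + d) * (e + d + 1) + (suc (e + d) + e)
      ∎
    where open ≡-Reasoning

-- The numbers t n, b n, c n and the bounds on k

t-intro : ∀ n v → n * suc n ≡ v * 2 → t n ≡ v
t-intro n v eq = trans (cong (_/ 2) eq) (m*n/n≡m v 2)

b-c-intro : ∀ n g B C .{{_ : NonZero g}} → t (suc n) ≡ g * B → t (suc (suc n)) ≡ g * C →
            Coprime B C → b n ≡ B × c n ≡ C
b-c-intro n g B C t₁ t₂ coprime = divide t₁ , divide t₂
  where
  d₁≡g : d₁ n ≡ g
  d₁≡g = begin
    gcd (t (suc n)) (t (suc (suc n)))   ≡⟨ cong₂ gcd t₁ t₂ ⟩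
    gcd (g * B) (g * C)                 ≡⟨ c*gcd[m,n]≡gcd[cm,cn] g B C ⟨
    g * gcd B C                         ≡⟨ cong (g *_) (coprime⇒gcd≡1 coprime) ⟩
    g * 1                               ≡⟨ *-identityʳ g ⟩
    g                                   ∎
    where open ≡-Reasoning
  divide : ∀ {T A} → T ≡ g * A → _/_ T (d₁ n) {{instance-d₁ n}} ≡ A
  divide {T} {A} T≡gA = begin
    _/_ T (d₁ n) {{instance-d₁ n}}   ≡⟨ /-congʳ {{instance-d₁ n}} d₁≡g ⟩
    T / g                            ≡⟨ cong (_/ g) (trans T≡gA (*-comm g A)) ⟩
    A * g / g                        ≡⟨ m*n/n≡m A g ⟩
    A                                ∎
    where open ≡-Reasoning

coprime-2m+1-2m+3 : ∀ m → Coprime (1 + 2 * m) (3 + 2 * m)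
coprime-2m+1-2m+3 m {i} (i∣1+2m , i∣3+2m) = ∣1⇒≡1 i∣1
  where
  i∣2 : i ∣ 2
  i∣2 = ∣m+n∣m⇒∣n (subst (i ∣_) (+-comm 2 (1 + 2 * m)) i∣3+2m) i∣1+2m
  i∣1 : i ∣ 1
  i∣1 = ∣m+n∣m⇒∣n (subst (i ∣_) (+-comm 1 (2 * m)) i∣1+2m) (∣m⇒∣m*n m i∣2)

coprime-m+1-m+2 : ∀ m → Coprime (1 + m) (2 + m)
coprime-m+1-m+2 m {i} (i∣1+m , i∣2+m) = ∣1⇒≡1 (∣m+n∣m⇒∣n (subst (i ∣_) (+-comm 1 (1 + m)) i∣2+m) i∣1+m)

even-arithmetic : ∀ m → t (2 * m) ≡ m * (1 + 2 * m) × b (2 * m) ≡ 1 + 2 * m × c (2 * m) ≡ 3 + 2 * m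
even-arithmetic m = t-intro (2 * m) _ tₙ
                   , b-c-intro (2 * m) (1 + m) (1 + 2 * m) (3 + 2 * m) (t-intro (suc (2 * m)) _ tₙ₊₁)
                               (t-intro (suc (suc (2 * m))) _ tₙ₊₂) (coprime-2m+1-2m+3 m)
  where
  tₙ : 2 * m * suc (2 * m) ≡ m * (1 + 2 * m) * 2
  tₙ = solve (m ∷ [])
  tₙ₊₁ : suc (2 * m) * suc (suc (2 * m)) ≡ (1 + m) * (1 + 2 * m) * 2
  tₙ₊₁ = solve (m ∷ [])
  tₙ₊₂ : suc (suc (2 * m)) * suc (suc (suc (2 * m))) ≡ (1 + m) * (3 + 2 * m) * 2
  tₙ₊₂ = solve (m ∷ [])

odd-arithmetic : ∀ m → t (1 + 2 * m) ≡ (1 + 2 * m) * (1 + m)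
                     × b (1 + 2 * m) ≡ 1 + m × c (1 + 2 * m) ≡ 2 + m
odd-arithmetic m = t-intro (1 + 2 * m) _ tₙ
                  , b-c-intro (1 + 2 * m) (3 + 2 * m) (1 + m) (2 + m) (t-intro (suc (1 + 2 * m)) _ tₙ₊₁)
                              (t-intro (suc (suc (1 + 2 * m))) _ tₙ₊₂) (coprime-m+1-m+2 m)
  where
  tₙ : (1 + 2 * m) * suc (1 + 2 * m) ≡ (1 + 2 * m) * (1 + m) * 2
  tₙ = solve (m ∷ [])
  tₙ₊₁ : suc (1 + 2 * m) * suc (suc (1 + 2 * m)) ≡ (3 + 2 * m) * (1 + m) * 2
  tₙ₊₁ = solve (m ∷ [])
  tₙ₊₂ : suc (suc (1 + 2 * m)) * suc (suc (suc (1 + 2 * m))) ≡ (3 + 2 * m) * (2 + m) * 2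
  tₙ₊₂ = solve (m ∷ [])

data EvenOrOdd : ℕ → Set where
  even : ∀ m → EvenOrOdd (2 * m)
  odd  : ∀ m → EvenOrOdd (1 + 2 * m)

evenOrOdd : ∀ n → EvenOrOdd n
evenOrOdd zero = even 0
evenOrOdd (suc n) with evenOrOdd n
... | even m = odd m
... | odd m  = subst EvenOrOdd (*-suc 2 m) (even (suc m))

isEven-even : ∀ m → isEven (2 * m) ≡ true
isEven-even m = cong (_≡ᵇ 0) (trans (cong (_% 2) (*-comm 2 m)) (m*n%n≡0 m 2))

isEven-odd : ∀ m → isEven (1 + 2 * m) ≡ false
isEven-odd m = cong (_≡ᵇ 0) (trans (cong (λ z → (1 + z) % 2) (*-comm 2 m)) ([m+kn]%n≡m%n 1 m 2))

data Position : ℕ → ℕ → Set where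
  lower : ∀ i d → Position (i + d) i
  upper : ∀ e d → Position (e + d) (suc (e + d) + e)

position : ∀ k i → i ≤ 2 * k + 1 → Position k i
position k i i≤2k+1 with i ≤? k
... | yes i≤k = subst (λ k → Position k i) (m+[n∸m]≡n i≤k) (lower i (k ∸ i))
... | no i≰k = subst (Position k) (m+[n∸m]≡n (≰⇒> i≰k))
                 (subst (λ k′ → Position k′ (suc k′ + e)) (m+[n∸m]≡n e≤k) (upper e (k ∸ e)))
  where
  e : ℕ
  e = i ∸ suc k
  e≤k : e ≤ k
  e≤k = subst (e ≤_) (m+n∸m≡n (suc k) k) (∸-monoˡ-≤ (suc k) (subst (i ≤_) split i≤2k+1))
    where
    split : 2 * k + 1 ≡ suc k + k
    split = solve (k ∷ [])

module _ (e d : ℕ) where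

  upper-≰ : ¬ suc (e + d) + e ≤ e + d
  upper-≰ h = 1+n≰n (≤-trans (m≤m+n (suc (e + d)) e) h)

  [1+k+e]∸k≡1+e : suc (e + d) + e ∸ (e + d) ≡ suc e
  [1+k+e]∸k≡1+e = trans (cong (_∸ (e + d)) (sym (+-suc (e + d) e))) (m+n∸m≡n (e + d) (suc e))

m+k≡n⇒m≤n : ∀ {m n} k → m + k ≡ n → m ≤ n
m+k≡n⇒m≤n {m} k refl = m≤m+n m k

largest-≥ : ∀ f X B r → r ≤ B → f r ≤ X → r ≤ largest f X B
largest-≥ f X zero    r r≤0  _     = r≤0
largest-≥ f X (suc B) r r≤1+B fr≤X with f (suc B) ≤? X
... | yes fB≤X rewrite dec-true (f (suc B) ≤? X) fB≤X = r≤1+B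
... | no fB≰X rewrite dec-false (f (suc B) ≤? X) fB≰X =
  largest-≥ f X B r (s≤s⁻¹ (≤∧≢⇒< r≤1+B λ { refl → fB≰X fr≤X })) fr≤X

isqrt-≥ : ∀ k i → k ≤ isqrt (k * (k + 1) + i + 1) × (k ≤ i → suc k ≤ isqrt (k * (k + 1) + i + 1))
isqrt-≥ k i = largest-≥ _ _ _ k k≤X k²≤X , λ k≤i → largest-≥ _ _ _ (suc k) 1+k≤X (square≤ k≤i)
  where
  k≤X : k ≤ k * (k + 1) + i + 1
  k≤X = m+k≡n⇒m≤n (k * k + i + 1) (solve (k ∷ i ∷ []))
  k²≤X : k * k ≤ k * (k + 1) + i + 1
  k²≤X = m+k≡n⇒m≤n (k + i + 1) (solve (k ∷ i ∷ []))
  1+k≤X : suc k ≤ k * (k + 1) + i + 1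
  1+k≤X = m+k≡n⇒m≤n (k * k + i) (solve (k ∷ i ∷ []))
  square≤ : k ≤ i → suc k * suc k ≤ k * (k + 1) + i + 1
  square≤ k≤i with m≤n⇒∃[o]m+o≡n k≤i
  ... | j , refl = m+k≡n⇒m≤n j (solve (k ∷ j ∷ []))

ihalf-≥ : ∀ k i → k ≤ ihalf (4 * (k * (k + 1) + i) + 5)
                × (i ≡ 2 * k + 1 → suc k ≤ ihalf (4 * (k * (k + 1) + i) + 5))
ihalf-≥ k i = largest-≥ _ _ _ k k≤X square≤X , λ { refl → largest-≥ _ _ _ (suc k) 1+k≤X′ square≡X′ }
  where
  k≤X : k ≤ 4 * (k * (k + 1) + i) + 5
  k≤X = m+k≡n⇒m≤n (4 * k * k + 3 * k + 4 * i + 5) (solve (k ∷ i ∷ []))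
  square≤X : (2 * k + 1) * (2 * k + 1) ≤ 4 * (k * (k + 1) + i) + 5
  square≤X = m+k≡n⇒m≤n (4 * i + 4) (solve (k ∷ i ∷ []))
  1+k≤X′ : suc k ≤ 4 * (k * (k + 1) + (2 * k + 1)) + 5
  1+k≤X′ = m+k≡n⇒m≤n (4 * k * k + 11 * k + 8) (solve (k ∷ []))
  square≡X′ : (2 * suc k + 1) * (2 * suc k + 1) ≤ 4 * (k * (k + 1) + (2 * k + 1)) + 5
  square≡X′ = ≤-reflexive (solve (k ∷ []))

ℤ-sub-< : ∀ a b c → ℤ.+ a ℤ.- ℤ.+ b ℤ.< ℤ.+ c → a < c + b
ℤ-sub-< a b c a-b<c with b ≤? a
... | yes b≤a = subst (_< c + b) (m∸n+n≡m b≤a) (+-monoˡ-< b (ℤᵖ.drop‿+<+ (subst (ℤ._< ℤ.+ c) a-b≡ a-b<c)))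
  where
  a-b≡ : ℤ.+ a ℤ.- ℤ.+ b ≡ ℤ.+ (a ∸ b)
  a-b≡ = trans (ℤᵖ.m-n≡m⊖n a b) (ℤᵖ.⊖-≥ b≤a)
... | no b≰a = <-≤-trans (≰⇒> b≰a) (m≤n+m b c)

Claim : ℕ → ℕ → ℕ → Set
Claim n k i = Σ ℤ λ g → IsGFrob (b n ∷ c n ∷ []) (xs n k i) g
                      × d (g ℤ.+ ℤ.+ (ys n k i * t n)) (t n ∷ b n ∷ c n ∷ []) ≡ k * (k + 1) + i

claim-intro : ∀ n k i {B C T x y} → t n ≡ T × b n ≡ B × c n ≡ C → xs n k i ≡ x × ys n k i ≡ y →
              (Σ ℤ λ g → IsGFrob (B ∷ C ∷ []) x g × d (g ℤ.+ ℤ.+ (y * T)) (T ∷ B ∷ C ∷ []) ≡ k * (k + 1) + i) →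
              Claim n k i
claim-intro _ _ _ (refl , refl , refl) (refl , refl) claim = claim

sum≤product-even : ∀ {m} → 0 < m → 1 + 2 * m + (3 + 2 * m) ≤ (1 + 2 * m) * (3 + 2 * m)
sum≤product-even {suc m} _ = m+k≡n⇒m≤n (4 * m * m + 12 * m + 7) (solve (m ∷ []))

sum≤product-odd : ∀ {m} → 0 < m → 1 + m + (2 + m) ≤ (1 + m) * (2 + m)
sum≤product-odd {suc m} _ = m+k≡n⇒m≤n (m * m + 3 * m + 1) (solve (m ∷ []))

module EvenCase (m : ℕ) .{{_ : NonZero m}} where
  open ThreeGenerators (1 + 2 * m) (3 + 2 * m) m (coprime-2m+1-2m+3 m) (sum≤product-even (>-nonZero⁻¹ m))
  open EvenLattice m Λ Λ-zero Λ-step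

  small-lower : ∀ i d → 3 * (i + d) < m + 3 → (i + d ≤ i → 3 * (i + d) < m) → 3 * i ≤ m
  small-lower i zero    _      3k<m =
    <⇒≤ (subst (λ k → 3 * k < m) (+-identityʳ i) (3k<m (≤-reflexive (+-identityʳ i))))
  small-lower i (suc d) 3k<m+3 _    = <⇒≤ (+-cancelʳ-< 3 (3 * i) m (begin-strict
    3 * i + 3          ≡⟨ solve (i ∷ []) ⟩
    3 * suc i          ≤⟨ *-monoʳ-≤ 3 (subst (suc i ≤_) (sym (+-suc i d)) (s≤s (m≤m+n i d))) ⟩
    3 * (i + suc d)    <⟨ 3k<m+3 ⟩
    m + 3              ∎))
    where open ≤-Reasoning

  lower-coordinates : ∀ i d → xs (2 * m) (i + d) i ≡ i × ys (2 * m) (i + d) i ≡ 2 * d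
  lower-coordinates i d rewrite isEven-even m | dec-true (i ≤? i + d) (m≤m+n i d) =
    refl , cong (2 *_) (m+n∸m≡n i d)

  upper-coordinates : ∀ e d → xs (2 * m) (e + d) (suc (e + d) + e) ≡ e
                            × ys (2 * m) (e + d) (suc (e + d) + e) ≡ suc (2 * d)
  upper-coordinates e d rewrite isEven-even m | dec-false (suc (e + d) + e ≤? e + d) (upper-≰ e d) =
    cong (_∸ 1) ([1+k+e]∸k≡1+e e d) ,
    trans (cong (_∸ 2 * (suc (e + d) + e)) split) (m+n∸n≡m (suc (2 * d)) (2 * (suc (e + d) + e)))
    where
    split : 4 * (e + d) + 3 ≡ suc (2 * d) + 2 * (suc (e + d) + e)
    split = solve (e ∷ d ∷ [])

  even-claim : ∀ {k i} → Position k i → 3 * k < m + 3 → (k ≤ i → 3 * k < m) → Claim (2 * m) k i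
  even-claim (lower i d) 3k<m+3 3k<m =
    claim-intro (2 * m) (i + d) i (even-arithmetic m) (lower-coordinates i d)
      (shifted-frobenius i (2 * d)
        (f-lower i d (small-lower i d 3k<m+3 3k<m) (≤-<-trans (*-monoʳ-≤ 3 (m≤n+m d i)) 3k<m+3)))
  even-claim (upper e d) _      3k<m =
    claim-intro (2 * m) (e + d) (suc (e + d) + e) (even-arithmetic m) (upper-coordinates e d)
      (shifted-frobenius e (suc (2 * d))
        (f-upper e d (3k<m (≤-trans (n≤1+n (e + d)) (m≤m+n (suc (e + d)) e)))))

module OddCase (m : ℕ) .{{_ : NonZero m}} where
  open ThreeGenerators (1 + m) (2 + m) (1 + 2 * m) (coprime-m+1-m+2 m) (sum≤product-odd (>-nonZero⁻¹ m))
  open OddLattice m Λ Λ-zero Λ-step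

  small-upper : ∀ e d → 3 * (e + d) < 2 + m → (suc (e + d) + e ≡ 2 * (e + d) + 1 → 3 * suc (e + d) < 2 + m) →
                3 * suc e ≤ 2 + m
  small-upper e zero    _       3k′<2+m =
    <⇒≤ (subst (λ k → 3 * suc k < 2 + m) (+-identityʳ e) (3k′<2+m (solve (e ∷ []))))
  small-upper e (suc d) 3k<2+m _        =
    ≤-trans (*-monoʳ-≤ 3 (subst (suc e ≤_) (sym (+-suc e d)) (s≤s (m≤m+n e d)))) (<⇒≤ 3k<2+m)

  lower-coordinates : ∀ i d → xs (1 + 2 * m) (i + d) i ≡ 2 * i × ys (1 + 2 * m) (i + d) i ≡ d
  lower-coordinates i d rewrite isEven-odd m | dec-true (i ≤? i + d) (m≤m+n i d) = refl , m+n∸m≡n i d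

  upper-coordinates : ∀ e d → xs (1 + 2 * m) (e + d) (suc (e + d) + e) ≡ suc (2 * e)
                            × ys (1 + 2 * m) (e + d) (suc (e + d) + e) ≡ d
  upper-coordinates e d rewrite isEven-odd m | dec-false (suc (e + d) + e ≤? e + d) (upper-≰ e d) =
    trans (cong (λ z → 2 * z ∸ 1) ([1+k+e]∸k≡1+e e d)) (cong (_∸ 1) (*-suc 2 e)) ,
    trans (cong (_∸ (suc (e + d) + e)) split) (m+n∸n≡m d (suc (e + d) + e))
    where
    split : 2 * (e + d) + 1 ≡ d + (suc (e + d) + e)
    split = solve (e ∷ d ∷ [])

  odd-claim : ∀ {k i} → Position k i → 3 * k < 2 + m → (i ≡ 2 * k + 1 → 3 * suc k < 2 + m) →
              Claim (1 + 2 * m) k i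
  odd-claim (lower i d) 3k<2+m _ =
    claim-intro (1 + 2 * m) (i + d) i (odd-arithmetic m) (lower-coordinates i d)
      (shifted-frobenius (2 * i) d
        (f-lower i d (<⇒≤ (≤-<-trans (*-monoʳ-≤ 3 (m≤m+n i d)) 3k<2+m))
                     (≤-<-trans (*-monoʳ-≤ 3 (m≤n+m d i)) 3k<2+m)))
  odd-claim (upper e d) 3k<2+m 3k′<2+m =
    claim-intro (1 + 2 * m) (e + d) (suc (e + d) + e) (odd-arithmetic m) (upper-coordinates e d)
      (shifted-frobenius (suc (2 * e)) d
        (f-upper e d (small-upper e d 3k<2+m 3k′<2+m) (≤-<-trans (*-monoʳ-≤ 3 (m≤n+m d e)) 3k<2+m)))

-- For n = 1 we have B = 1, the Frobenius number g(1, 2; 0) = −1 is negative, and the bound on n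
-- forces k = i = 0.
one-claim : ∀ k i → i ≤ 2 * k + 1 → 3 * k < 2 → (i ≡ 2 * k + 1 → 3 * suc k < 2) → Claim 1 k i
one-claim zero zero          _        _ _ =
  claim-intro 1 0 0 (odd-arithmetic 0) (refl , refl) (ℤ.-[1+ 0 ] , (z≤n , above) , refl)
  where
  above : ∀ m′ → ℤ.-[1+ 0 ] ℤ.< m′ → 0 < d m′ (1 ∷ 2 ∷ [])
  above (ℤ.+ M) _ = PairOfGenerators.frobenius-above 1 2 (coprime-m+1-m+2 0) 0 M (m≤n+m 3 M)
  above ℤ.-[1+ _ ] (ℤ.-<- ())
one-claim zero (suc zero)    _        _ 3<2 = contradiction (3<2 refl) λ { (s≤s (s≤s ())) }
one-claim zero (suc (suc i)) (s≤s ()) _ _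
one-claim (suc k) _ _ 3k<2 _ = contradiction 3k<2 (≤⇒≯ (≤-trans (n≤1+n 2) (*-monoʳ-≤ 3 (s≤s (z≤n {k})))))

even-bounds : ∀ k i m → Nbound (2 * m) (k * (k + 1) + i) ℤ.< ℤ.+ (2 * m) →
              3 * k < m + 3 × (k ≤ i → 3 * k < m)
even-bounds k i m bound = ≤-<-trans (*-monoʳ-≤ 3 (proj₁ (isqrt-≥ k i))) 3√<m+3
                        , λ k≤i → +-cancelʳ-< 3 (3 * k) m (subst (_< m + 3) (3[1+k]≡3k+3 k)
                                    (≤-<-trans (*-monoʳ-≤ 3 (proj₂ (isqrt-≥ k i) k≤i)) 3√<m+3))
  where
  √ : ℕ
  √ = isqrt (k * (k + 1) + i + 1)
  Neven≡ : Nbound (2 * m) (k * (k + 1) + i) ≡ ℤ.+ (6 * √) ℤ.- ℤ.+ 6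
  Neven≡ rewrite isEven-even m = refl
  six : 6 * √ ≡ 2 * (3 * √)
  six = *-assoc 2 3 √
  double : 2 * m + 6 ≡ 2 * (m + 3)
  double = solve (m ∷ [])
  3√<m+3 : 3 * √ < m + 3
  3√<m+3 = *-cancelˡ-< 2 (3 * √) (m + 3)
             (subst₂ _<_ six double (ℤ-sub-< (6 * √) 6 (2 * m) (subst (ℤ._< ℤ.+ (2 * m)) Neven≡ bound)))
  3[1+k]≡3k+3 : ∀ k → 3 * suc k ≡ 3 * k + 3
  3[1+k]≡3k+3 k = solve (k ∷ [])

odd-bounds : ∀ k i m → Nbound (1 + 2 * m) (k * (k + 1) + i) ℤ.< ℤ.+ (1 + 2 * m) →
             3 * k < 2 + m × (i ≡ 2 * k + 1 → 3 * suc k < 2 + m)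
odd-bounds k i m bound = ≤-<-trans (*-monoʳ-≤ 3 (proj₁ (ihalf-≥ k i))) 3h<2+m
                       , λ i≡ → ≤-<-trans (*-monoʳ-≤ 3 (proj₂ (ihalf-≥ k i) i≡)) 3h<2+m
  where
  h : ℕ
  h = ihalf (4 * (k * (k + 1) + i) + 5)
  Nodd≡ : Nbound (1 + 2 * m) (k * (k + 1) + i) ≡ ℤ.+ (6 * h) ℤ.- ℤ.+ 3
  Nodd≡ rewrite isEven-odd m = refl
  six : 6 * h ≡ 2 * (3 * h)
  six = *-assoc 2 3 h
  double : 1 + 2 * m + 3 ≡ 2 * (2 + m)
  double = solve (m ∷ [])
  3h<2+m : 3 * h < 2 + m
  3h<2+m = *-cancelˡ-< 2 (3 * h) (2 + m)
             (subst₂ _<_ six double (ℤ-sub-< (6 * h) 3 (1 + 2 * m) (subst (ℤ._< ℤ.+ (1 + 2 * m)) Nodd≡ bound)))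

lemma2p7 : (k i n : ℕ) → i ≤ 2 * k + 1 → 0 < n →
           Nbound n (k * (k + 1) + i) ℤ.< ℤ.+ n →
           Σ ℤ (λ m → IsGFrob (b n ∷ c n ∷ []) (xs n k i) m
                      × d (m ℤ.+ ℤ.+ (ys n k i * t n)) (t n ∷ b n ∷ c n ∷ []) ≡ k * (k + 1) + i)
lemma2p7 k i n i≤2k+1 0<n bound with evenOrOdd n
... | even zero = contradiction 0<n (λ ())
... | even m@(suc _) = let (3k<m+3 , 3k<m) = even-bounds k i m bound in
                       EvenCase.even-claim m (position k i i≤2k+1) 3k<m+3 3k<m
... | odd zero = let (3k<2 , 3k′<2) = odd-bounds k i 0 bound in one-claim k i i≤2k+1 3k<2 3k′<2
... | odd m@(suc _) = let (3k<2+m , 3k′<2+m) = odd-bounds k i m bound in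
                      OddCase.odd-claim m (position k i i≤2k+1) 3k<2+m 3k′<2+m
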